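{- Let $n,k,h$ be integers with $3\leqslant k\leqslant n-1$ and $1\leqslant h\leqslant n-k$. Let $S$ be a minimum $h$-cut of $S_{n,k}$ (i.e. an $h$-cut with $|S|=\kappa_s^{(h)}(S_{n,k})$), and let $X$ be the vertex set of a connected component of $S_{n,k}-S$. Fix any $t\in\{2,\ldots,k\}$. Put $Y=V(S_{n,k})\setminus(S\cup X)$ and, for $i\in I_n$, $X_i=X\cap V(S^{t:i}_{n-1,k-1})$, $Y_i=Y\cap V(S^{t:i}_{n-1,k-1})$, $S_i=S\cap V(S^{t:i}_{n-1,k-1})$. Let $J=\{i\in I_n: X_i\neq\emptyset\}$, $J'=\{i\in J: Y_i\neq\emptyset\}$, and $T=\{i\in I_n: Y_i\neq\emptyset\}$. Then: (a) for every $i\in J'$, $S_i$ is an $(h-1)$-cut of $S^{t:i}_{n-1,k-1}$; (b) $\kappa_s^{(h)}(S_{n,k})\geqslant |J'|\,\kappa_s^{(h-1)}(S_{n-1,k-1})$; (c) $J\cup T=I_n$.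
   Context: Let $I_n=\{1,\ldots,n\}$ and for $1\leqslant k\leqslant n-1$ let $P(n,k)$ be the set of $k$-permutations $p_1p_2\cdots p_k$ of distinct elements of $I_n$. The $(n,k)$-star graph $S_{n,k}$ has vertex set $P(n,k)$, and a vertex $p=p_1p_2\cdots p_k$ is adjacent to (a) $p_ip_2\cdots p_{i-1}p_1p_{i+1}\cdots p_k$ for each $2\leqslant i\leqslant k$ (swap-edges), and (b) $\alpha p_2\cdots p_k$ for each $\alpha\in I_n\setminus\{p_1,\ldots,p_k\}$ (unswap-edges). For $2\leqslant t\leqslant k$ and $i\in I_n$, $S^{t:i}_{n-1,k-1}$ denotes the subgraph of $S_{n,k}$ induced by all vertices whose $t$-th symbol is $i$ (it is isomorphic to $S_{n-1,k-1}$). For a connected graph $G$ and integer $h\geqslant 0$, a set $S\subseteq V(G)$ is an $h$-cut if $G-S$ is disconnected and has minimum degree at least $h$; $\kappa_s^{(h)}(G)$ is the minimum cardinality of an $h$-cut of $G$. -}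

module Defs where

open import Data.Nat using (ℕ; zero; suc; _≤_; _∸_)
open import Data.Bool using (Bool; true; false; not; _∧_; _∨_; if_then_else_)
open import Data.Fin using (Fin; _≟_)
open import Data.List using (List; []; _∷_; map; filter; concatMap; length; allFin; _++_)
open import Data.Bool.ListAction using (any)
open import Data.List.Membership.Propositional using (_∈_)
open import Data.Vec using (Vec; []; _∷_; lookup; _[_]≔_)
open import Data.Product using (Σ; _×_; _,_; ∃)
open import Relation.Nullary using (¬_; does)
open import Relation.Binary.PropositionalEquality using (_≡_)
open import Function.Bundles using (_⇔_)

-- Generic finite (simple, undirected) graphs over a carrier type V:
-- a list of vertices and, for each vertex, the list of its neighbours.
-- Vertex subsets are Boolean predicates on V.

record Graph (V : Set) : Set where
  field
    verts : List V
    nbrs  : V → List V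
open Graph public

countL : {A : Set} → (A → Bool) → List A → ℕ
countL P xs = length (filter (λ x → P x Data.Bool.≟ true) xs)

card : {V : Set} → Graph V → (V → Bool) → ℕ
card G S = countL S (verts G)

induced : {V : Set} → (V → Bool) → Graph V → Graph V
induced P G = record
  { verts = filter (λ v → P v Data.Bool.≟ true) (verts G)
  ; nbrs  = λ v → filter (λ w → P w Data.Bool.≟ true) (nbrs G v) }

_─_ : {V : Set} → Graph V → (V → Bool) → Graph V
G ─ S = induced (λ v → not (S v)) G

data Reach {V : Set} (G : Graph V) : V → V → Set where
  here : ∀ {u} → Reach G u u
  step : ∀ {u w v} → w ∈ nbrs G u → Reach G w v → Reach G u v

Disconnected : {V : Set} → Graph V → Set
Disconnected G = Σ _ λ u → Σ _ λ v → u ∈ verts G × v ∈ verts G × ¬ Reach G u v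

degree : {V : Set} → Graph V → V → ℕ
degree G v = length (nbrs G v)

MinDegAtLeast : {V : Set} → Graph V → ℕ → Set
MinDegAtLeast G h = ∀ v → v ∈ verts G → h ≤ degree G v

IsHCut : {V : Set} → ℕ → Graph V → (V → Bool) → Set
IsHCut h G S = Disconnected (G ─ S) × MinDegAtLeast (G ─ S) h

IsMinHCut : {V : Set} → ℕ → Graph V → (V → Bool) → Set
IsMinHCut h G S = IsHCut h G S × (∀ S' → IsHCut h G S' → card G S ≤ card G S')

IsKappa : {V : Set} → ℕ → Graph V → ℕ → Set
IsKappa h G m = (Σ _ λ S → IsHCut h G S × card G S ≡ m)
              × (∀ S → IsHCut h G S → m ≤ card G S)

IsComponent : {V : Set} → Graph V → (V → Bool) → Set
IsComponent G X = Σ _ λ x₀ → x₀ ∈ verts G ×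
  (∀ v → (X v ≡ true) ⇔ (v ∈ verts G × Reach G x₀ v))

-- The (n,k)-star graph. Symbols of I_n are represented by Fin n
-- (i.e. relabelled 0..n-1), positions 1..k by Fin k (0..k-1).

memB : ∀ {n m} → Fin n → Vec (Fin n) m → Bool
memB a [] = false
memB a (b ∷ w) = does (a ≟ b) ∨ memB a w

distinctB : ∀ {n m} → Vec (Fin n) m → Bool
distinctB [] = true
distinctB (a ∷ w) = not (memB a w) ∧ distinctB w

allVecs : (n k : ℕ) → List (Vec (Fin n) k)
allVecs n zero = [] ∷ []
allVecs n (suc k) = concatMap (λ a → map (a ∷_) (allVecs n k)) (allFin n)

perms : (n k : ℕ) → List (Vec (Fin n) k)
perms n k = filter (λ v → distinctB v Data.Bool.≟ true) (allVecs n k)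

-- neighbours: swap-edges (swap positions 1 and i, 2 ≤ i ≤ k)
-- followed by unswap-edges (replace p₁ by α ∉ {p₁,…,p_k})
starNbrs : ∀ {n k} → Vec (Fin n) k → List (Vec (Fin n) k)
starNbrs [] = []
starNbrs {n} {suc k} (a ∷ w) =
  map (λ i → lookup w i ∷ (w [ i ]≔ a)) (allFin k)
  ++ map (λ α → α ∷ w) (filter (λ α → memB α (a ∷ w) Data.Bool.≟ false) (allFin n))

Star : (n k : ℕ) → Graph (Vec (Fin n) k)
Star n k = record { verts = perms n k ; nbrs = starNbrs }

StarSub : (n k : ℕ) → Fin k → Fin n → Graph (Vec (Fin n) k)
StarSub n k t i = induced (λ v → does (lookup v t ≟ i)) (Star n k)

nonemptyIn : (n k : ℕ) → Fin k → (Vec (Fin n) k → Bool) → Fin n → Bool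
nonemptyIn n k t Z i = any Z (verts (StarSub n k t i))

Ycompl : ∀ {n k} → (S X : Vec (Fin n) k → Bool) → Vec (Fin n) k → Bool
Ycompl S X v = not (S v) ∧ not (X v)

Jset : (n k : ℕ) → Fin k → (S X : Vec (Fin n) k → Bool) → Fin n → Bool
Jset n k t S X i = nonemptyIn n k t X i

Tset : (n k : ℕ) → Fin k → (S X : Vec (Fin n) k → Bool) → Fin n → Bool
Tset n k t S X i = nonemptyIn n k t (Ycompl S X) i

J'set : (n k : ℕ) → Fin k → (S X : Vec (Fin n) k → Bool) → Fin n → Bool
J'set n k t S X i = Jset n k t S X i ∧ Tset n k t S X i

cardFin : (n : ℕ) → (Fin n → Bool) → ℕ
cardFin n P = countL P (allFin n)

-- (a) A vertex of S^{t:i} with t ≥ 2 has exactly one neighbour outside S^{t:i}, the swap with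
-- position t, so S_i inherits minimum degree h − 1 from S; and X_i, Y_i lie in different
-- components of S^{t:i} − S_i because a walk there is a walk of S_{n,k} − S.
-- (b) S^{t:i} ≅ S_{n−1,k−1}, so by (a) each S_i with i ∈ J' has at least κ_s^{(h−1)}(S_{n−1,k−1})
-- elements, and the S_i are disjoint.
-- (c) Suppose S ⊇ V(S^{t:i}). Take a vertex α₀ q of S^{t:i} and the class
-- C = {α q : α ∉ q} ⊆ S^{t:i}. Its swap-neighbourhood B is an h-cut (every vertex keeps ≥ n − k ≥ h
-- neighbours off B, and C is cut off), and only |C| vertices of B lie outside S^{t:i}. But S^{t:i}
-- contains B ∩ S^{t:i}, C and one further vertex, all disjoint, so |S| > |B|, contradicting minimality.

module Submission where

open import Defs
open import Data.Nat using (ℕ; zero; suc; _≤_; _∸_; _*_; _+_; z≤n; s≤s)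
open import Data.Nat.Properties
  using (≤-trans; n≤1+n; m≤n⇒m≤1+n; m≤n+m; 1+n≰n; +-suc; +-comm; +-mono-≤; +-monoˡ-≤; +-monoʳ-≤;
         +-cancelˡ-≤; ∸-monoˡ-≤; ∸-monoʳ-≤; m+n∸m≡n; m+n∸n≡m; m<n⇒0<n∸m; module ≤-Reasoning)
open import Data.Bool using (Bool; true; false; not; _∧_; _∨_) renaming (_≟_ to _≟ᵇ_)
open import Data.Bool.ListAction using (any)
open import Data.Fin using (Fin; zero; suc; toℕ; punchIn; punchOut) renaming (_≟_ to _≟ᶠ_)
open import Data.Fin.Properties using (0≢1+n; suc-injective; punchIn-injective; punchInᵢ≢i; punchIn-punchOut)
open import Data.Vec using (Vec; []; _∷_; head; tail; lookup; _[_]≔_; insertAt; tabulate) renaming (map to mapᵛ)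
import Data.Vec.Properties as Vecₚ
open import Data.List using (List; []; _∷_; map; filter; concatMap; length; allFin; _++_)
open import Data.List.Properties using (length-++; length-map; length-tabulate; filter-++; map-++; map-∘)
open import Data.List.Membership.Propositional using (_∈_; find)
open import Data.List.Membership.Propositional.Properties
  using (∈-filter⁻; ∈-filter⁺; ∈-map⁻; ∈-map⁺; ∈-allFin; ∈-++⁻; ∈-++⁺ˡ; ∈-++⁺ʳ; ∈-concatMap⁻; ∈-concatMap⁺)
open import Data.List.Relation.Binary.Subset.Propositional using (_⊆_)
open import Data.List.Relation.Unary.Any as Any using (here; there; satisfied; any?)
open import Data.List.Relation.Unary.All using ([])
open import Data.List.Relation.Unary.All.Properties using (All¬⇒¬Any)
open import Data.List.Relation.Unary.AllPairs using ([]; _∷_)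
open import Data.List.Relation.Unary.Unique.Propositional using (Unique)
import Data.List.Relation.Unary.Unique.Propositional.Properties as Unique
open import Data.Product using (_×_; _,_; ∃; proj₁; proj₂)
open import Data.Sum using (_⊎_; inj₁; inj₂)
open import Data.Empty using (⊥; ⊥-elim)
open import Relation.Nullary using (¬_; yes; no; does)
open import Relation.Nullary.Decidable using (dec-true)
open import Relation.Binary.Definitions using (DecidableEquality)
open import Relation.Binary.PropositionalEquality
open import Function using (_∘_; id; case_of_)
open import Function.Bundles using (Equivalence)

filterᵇ : {A : Set} → (A → Bool) → List A → List A
filterᵇ P = filter (λ x → P x ≟ᵇ true)

not≡true⇒≡false : ∀ {b} → not b ≡ true → b ≡ false
not≡true⇒≡false {false} _ = refl

≡false⇒not≡true : ∀ {b} → b ≡ false → not b ≡ true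
≡false⇒not≡true refl = refl

∧≡true⇒ : ∀ {a b} → a ∧ b ≡ true → a ≡ true × b ≡ true
∧≡true⇒ {true} {true} _ = refl , refl

module _ {A : Set} (_≟_ : DecidableEquality A) where

  private
    delete : A → List A → List A
    delete x [] = []
    delete x (y ∷ ys) with x ≟ y
    ... | yes _ = ys
    ... | no _ = y ∷ delete x ys

    length-delete : ∀ {x} ys → x ∈ ys → suc (length (delete x ys)) ≡ length ys
    length-delete {x} (y ∷ ys) x∈ with x ≟ y
    ... | yes _ = refl
    length-delete {x} (y ∷ ys) (here x≡y) | no x≢y = ⊥-elim (x≢y x≡y)
    length-delete {x} (y ∷ ys) (there x∈) | no _ = cong suc (length-delete ys x∈)

    ∈-delete : ∀ {x z} ys → z ∈ ys → z ≢ x → z ∈ delete x ys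
    ∈-delete {x} (y ∷ ys) z∈ z≢x with x ≟ y
    ∈-delete {x} (y ∷ ys) (here refl) z≢x | yes refl = ⊥-elim (z≢x refl)
    ∈-delete {x} (y ∷ ys) (there z∈) z≢x | yes _ = z∈
    ∈-delete {x} (y ∷ ys) (here z≡y) z≢x | no _ = here z≡y
    ∈-delete {x} (y ∷ ys) (there z∈) z≢x | no _ = there (∈-delete ys z∈ z≢x)

  unique⊆⇒length≤ : ∀ {xs ys} → Unique xs → xs ⊆ ys → length xs ≤ length ys
  unique⊆⇒length≤ {[]} _ _ = z≤n
  unique⊆⇒length≤ {x ∷ xs} {ys} (x∉xs ∷ u) xs⊆ys =
    subst (_ ≤_) (length-delete ys (xs⊆ys (here refl)))
      (s≤s (unique⊆⇒length≤ u λ z∈ → ∈-delete ys (xs⊆ys (there z∈)) λ { refl → All¬⇒¬Any x∉xs z∈ }))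

module _ {A : Set} where

  ∈-filterᵇ⁻ : ∀ {P : A → Bool} {x xs} → x ∈ filterᵇ P xs → x ∈ xs × P x ≡ true
  ∈-filterᵇ⁻ = ∈-filter⁻ (λ y → _ ≟ᵇ true)

  ∈-filterᵇ⁺ : ∀ {P : A → Bool} {x xs} → x ∈ xs → P x ≡ true → x ∈ filterᵇ P xs
  ∈-filterᵇ⁺ = ∈-filter⁺ (λ y → _ ≟ᵇ true)

  filterᵇ-unique : ∀ (P : A → Bool) {xs} → Unique xs → Unique (filterᵇ P xs)
  filterᵇ-unique P = Unique.filter⁺ (λ y → P y ≟ᵇ true)

  any-true⇒∃ : ∀ (P : A → Bool) xs → any P xs ≡ true → ∃ λ x → x ∈ xs × P x ≡ true
  any-true⇒∃ P (x ∷ xs) e with P x in Px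
  ... | true = x , here refl , Px
  ... | false = let (y , y∈ , Py) = any-true⇒∃ P xs e in y , there y∈ , Py

  any-false⇒∀ : ∀ (P : A → Bool) xs → any P xs ≡ false → ∀ x → x ∈ xs → P x ≡ false
  any-false⇒∀ P (x ∷ xs) e y y∈ with P x in Px
  any-false⇒∀ P (x ∷ xs) () y y∈ | true
  any-false⇒∀ P (x ∷ xs) e y (here refl) | false = Px
  any-false⇒∀ P (x ∷ xs) e y (there y∈) | false = any-false⇒∀ P xs e y y∈

  countL-mono : ∀ (P Q : A → Bool) xs → (∀ x → x ∈ xs → P x ≡ true → Q x ≡ true) →
                countL P xs ≤ countL Q xs
  countL-mono P Q [] _ = z≤n
  countL-mono P Q (x ∷ xs) P⇒Q with P x in Px | Q x in Qx
  ... | true | true = s≤s (countL-mono P Q xs λ y y∈ → P⇒Q y (there y∈))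
  ... | true | false with () ← trans (sym (P⇒Q x (here refl) Px)) Qx
  ... | false | true = m≤n⇒m≤1+n (countL-mono P Q xs λ y y∈ → P⇒Q y (there y∈))
  ... | false | false = countL-mono P Q xs λ y y∈ → P⇒Q y (there y∈)

  countL-all : ∀ (P : A → Bool) xs → (∀ x → x ∈ xs → P x ≡ true) → countL P xs ≡ length xs
  countL-all P [] _ = refl
  countL-all P (x ∷ xs) allP rewrite allP x (here refl) =
    cong suc (countL-all P xs λ y y∈ → allP y (there y∈))

  countL-pos : ∀ (P : A → Bool) {x} xs → x ∈ xs → P x ≡ true → 1 ≤ countL P xs
  countL-pos P (y ∷ xs) (here refl) Px rewrite Px = s≤s z≤n
  countL-pos P (y ∷ xs) (there x∈) Px with P y
  ... | true = s≤s z≤n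
  ... | false = countL-pos P xs x∈ Px

  countL-++ : ∀ (P : A → Bool) xs ys → countL P (xs ++ ys) ≡ countL P xs + countL P ys
  countL-++ P xs ys = trans (cong length (filter-++ (λ x → P x ≟ᵇ true) xs ys)) (length-++ (filterᵇ P xs))

  countL+countL-not : ∀ (P : A → Bool) xs → countL P xs + countL (not ∘ P) xs ≡ length xs
  countL+countL-not P [] = refl
  countL+countL-not P (x ∷ xs) with P x
  ... | true = cong suc (countL+countL-not P xs)
  ... | false = trans (+-suc _ _) (cong suc (countL+countL-not P xs))

  countL-∧-split : ∀ (P Q : A → Bool) xs →
    countL P xs ≡ countL (λ x → P x ∧ Q x) xs + countL (λ x → P x ∧ not (Q x)) xs
  countL-∧-split P Q [] = refl
  countL-∧-split P Q (x ∷ xs) with P x | Q x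
  ... | true | true = cong suc (countL-∧-split P Q xs)
  ... | true | false = trans (cong suc (countL-∧-split P Q xs)) (sym (+-suc _ _))
  ... | false | _ = countL-∧-split P Q xs

  countL≤countL-filterᵇ+countL-not : ∀ (Q P : A → Bool) xs →
    countL Q xs ≤ countL Q (filterᵇ P xs) + countL (not ∘ P) xs
  countL≤countL-filterᵇ+countL-not Q P [] = z≤n
  countL≤countL-filterᵇ+countL-not Q P (x ∷ xs) with P x | Q x in Qx
  ... | true | true rewrite Qx = s≤s (countL≤countL-filterᵇ+countL-not Q P xs)
  ... | true | false rewrite Qx = countL≤countL-filterᵇ+countL-not Q P xs
  ... | false | true = subst (suc (countL Q xs) ≤_) (sym (+-suc _ _)) (s≤s (countL≤countL-filterᵇ+countL-not Q P xs))
  ... | false | false = ≤-trans (countL≤countL-filterᵇ+countL-not Q P xs) (+-monoʳ-≤ _ (n≤1+n _))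

  countL-≤-cover : DecidableEquality A → (P : A → Bool) → ∀ {xs} (M : List A) → Unique xs →
    (∀ x → x ∈ xs → P x ≡ true → x ∈ M) → countL P xs ≤ length M
  countL-≤-cover _≟_ P M u cover =
    unique⊆⇒length≤ _≟_ (filterᵇ-unique P u) λ x∈ → let (x∈xs , Px) = ∈-filterᵇ⁻ {P = P} x∈ in cover _ x∈xs Px

  unique-concatMap : ∀ {B : Set} (f : B → List A) {bs : List B} → Unique bs →
    (∀ b → Unique (f b)) → (∀ {a b x} → x ∈ f a → x ∈ f b → a ≡ b) → Unique (concatMap f bs)
  unique-concatMap f {[]} _ _ _ = []
  unique-concatMap f {b ∷ bs} (b∉bs ∷ u) uf disjoint =
    Unique.++⁺ (uf b) (unique-concatMap f u uf disjoint)
      λ (x∈fb , x∈rest) → All¬⇒¬Any b∉bs (Any.map (disjoint x∈fb) (∈-concatMap⁻ f {xs = bs} x∈rest))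

≗-lookup⇒≡ : ∀ {A : Set} {k} (u v : Vec A k) → (∀ r → lookup u r ≡ lookup v r) → u ≡ v
≗-lookup⇒≡ [] [] _ = refl
≗-lookup⇒≡ (x ∷ u) (y ∷ v) eq = cong₂ _∷_ (eq zero) (≗-lookup⇒≡ u v (eq ∘ suc))

lookup-[]≔ : ∀ {A : Set} {k} (w : Vec A k) j a r →
  (r ≡ j × lookup (w [ j ]≔ a) r ≡ a) ⊎ (r ≢ j × lookup (w [ j ]≔ a) r ≡ lookup w r)
lookup-[]≔ w j a r with r ≟ᶠ j
... | yes refl = inj₁ (refl , Vecₚ.lookup∘update r w a)
... | no r≢j = inj₂ (r≢j , Vecₚ.lookup∘update′ r≢j w a)

_≟ᵛ_ : ∀ {n k} → DecidableEquality (Vec (Fin n) k)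
_≟ᵛ_ = Vecₚ.≡-dec _≟ᶠ_

does≡true⇒≡ : ∀ {n} {x y : Fin n} → does (x ≟ᶠ y) ≡ true → x ≡ y
does≡true⇒≡ {x = x} {y} e with x ≟ᶠ y
... | yes x≡y = x≡y

module _ {n : ℕ} where

  memB⇒lookup : ∀ {k} {a : Fin n} (w : Vec (Fin n) k) → memB a w ≡ true → ∃ λ r → lookup w r ≡ a
  memB⇒lookup {a = a} (b ∷ w) e with a ≟ᶠ b
  ... | yes refl = zero , refl
  ... | no _ = let (r , wr≡a) = memB⇒lookup w e in suc r , wr≡a

  lookup⇒memB : ∀ {k} {a : Fin n} (w : Vec (Fin n) k) r → lookup w r ≡ a → memB a w ≡ true
  lookup⇒memB {a = a} (b ∷ w) zero refl with a ≟ᶠ a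
  ... | yes _ = refl
  ... | no a≢a = ⊥-elim (a≢a refl)
  lookup⇒memB {a = a} (b ∷ w) (suc r) e with a ≟ᶠ b
  ... | yes _ = refl
  ... | no _ = lookup⇒memB w r e

  memB-false⁺ : ∀ {k} {a : Fin n} (w : Vec (Fin n) k) → (∀ r → lookup w r ≢ a) → memB a w ≡ false
  memB-false⁺ {a = a} w a∉ with memB a w in e
  ... | false = refl
  ... | true = ⊥-elim (let (r , wr≡a) = memB⇒lookup w e in a∉ r wr≡a)

  memB-false⁻ : ∀ {k} {a : Fin n} (w : Vec (Fin n) k) → memB a w ≡ false → ∀ r → lookup w r ≢ a
  memB-false⁻ w e r wr≡a with () ← trans (sym (lookup⇒memB w r wr≡a)) e

  memB-∷⁻ : ∀ {k} {b : Fin n} a (w : Vec (Fin n) k) → memB b (a ∷ w) ≡ false → b ≢ a × memB b w ≡ false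
  memB-∷⁻ a w e = (λ b≡a → memB-false⁻ (_ ∷ w) e zero (sym b≡a)) , memB-false⁺ w (memB-false⁻ (_ ∷ w) e ∘ suc)

  Distinct : ∀ {k} → Vec (Fin n) k → Set
  Distinct {k} w = ∀ (r s : Fin k) → lookup w r ≡ lookup w s → r ≡ s

  Distinct-∷⁻ : ∀ {k} {a : Fin n} {w : Vec (Fin n) k} → Distinct (a ∷ w) → memB a w ≡ false × Distinct w
  Distinct-∷⁻ {w = w} d =
    memB-false⁺ w (λ r wr≡a → 0≢1+n (d zero (suc r) (sym wr≡a))) ,
    λ r s eq → suc-injective (d (suc r) (suc s) eq)

  Distinct-∷⁺ : ∀ {k} {a : Fin n} {w : Vec (Fin n) k} → memB a w ≡ false → Distinct w → Distinct (a ∷ w)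
  Distinct-∷⁺ a∉w d zero zero _ = refl
  Distinct-∷⁺ {w = w} a∉w d zero (suc s) eq = ⊥-elim (memB-false⁻ w a∉w s (sym eq))
  Distinct-∷⁺ {w = w} a∉w d (suc r) zero eq = ⊥-elim (memB-false⁻ w a∉w r eq)
  Distinct-∷⁺ a∉w d (suc r) (suc s) eq = cong suc (d r s eq)

  distinctB⇒Distinct : ∀ {k} (w : Vec (Fin n) k) → distinctB w ≡ true → Distinct w
  distinctB⇒Distinct (a ∷ w) e with memB a w in a∈w | distinctB w in dw
  ... | false | true = Distinct-∷⁺ a∈w (distinctB⇒Distinct w dw)
  distinctB⇒Distinct (a ∷ w) () | true | _
  distinctB⇒Distinct (a ∷ w) () | false | false

  Distinct⇒distinctB : ∀ {k} (w : Vec (Fin n) k) → Distinct w → distinctB w ≡ true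
  Distinct⇒distinctB [] _ = refl
  Distinct⇒distinctB (a ∷ w) d with Distinct-∷⁻ d
  ... | a∉w , dw rewrite a∉w | Distinct⇒distinctB w dw = refl

  ∈-allVecs : ∀ {k} (v : Vec (Fin n) k) → v ∈ allVecs n k
  ∈-allVecs [] = here refl
  ∈-allVecs {suc k} (a ∷ v) =
    ∈-concatMap⁺ (λ b → map (b ∷_) (allVecs n k))
      (Any.map (λ { refl → ∈-map⁺ (a ∷_) (∈-allVecs v) }) (∈-allFin a))

  allVecs-unique : ∀ k → Unique (allVecs n k)
  allVecs-unique zero = [] ∷ []
  allVecs-unique (suc k) =
    unique-concatMap (λ b → map (b ∷_) (allVecs n k)) (Unique.allFin⁺ n)
      (λ b → Unique.map⁺ Vecₚ.∷-injectiveʳ (allVecs-unique k)) same-head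
    where
      same-head : ∀ {a b} {x : Vec (Fin n) (suc k)} →
        x ∈ map (a ∷_) (allVecs n k) → x ∈ map (b ∷_) (allVecs n k) → a ≡ b
      same-head x∈a x∈b with ∈-map⁻ _ x∈a | ∈-map⁻ _ x∈b
      ... | _ , _ , refl | _ , _ , refl = refl

  perms-unique : ∀ k → Unique (perms n k)
  perms-unique k = filterᵇ-unique distinctB (allVecs-unique k)

  ∈-perms⁺ : ∀ {k} {v : Vec (Fin n) k} → Distinct v → v ∈ perms n k
  ∈-perms⁺ {v = v} d = ∈-filterᵇ⁺ {P = distinctB} (∈-allVecs v) (Distinct⇒distinctB v d)

  ∈-perms⁻ : ∀ {k} {v : Vec (Fin n) k} → v ∈ perms n k → Distinct v
  ∈-perms⁻ {k} {v} v∈ = distinctB⇒Distinct v (proj₂ (∈-filterᵇ⁻ {P = distinctB} {xs = allVecs n k} v∈))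

module _ {n : ℕ} where

  swapNbr : ∀ {k} → Fin n → Vec (Fin n) k → Fin k → Vec (Fin n) (suc k)
  swapNbr a w j = lookup w j ∷ (w [ j ]≔ a)

  freeSymbols : ∀ {k} → Vec (Fin n) k → List (Fin n)
  freeSymbols v = filter (λ α → memB α v ≟ᵇ false) (allFin n)

  swapNbrs : ∀ {k} → Fin n → Vec (Fin n) k → List (Vec (Fin n) (suc k))
  swapNbrs {k} a w = map (swapNbr a w) (allFin k)

  unswapNbrs : ∀ {k} → Fin n → Vec (Fin n) k → List (Vec (Fin n) (suc k))
  unswapNbrs a w = map (_∷ w) (freeSymbols (a ∷ w))

  ∈-freeSymbols⁻ : ∀ {k α} (v : Vec (Fin n) k) → α ∈ freeSymbols v → memB α v ≡ false
  ∈-freeSymbols⁻ v α∈ = proj₂ (∈-filter⁻ (λ α → memB α v ≟ᵇ false) {xs = allFin n} α∈)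

  ∈-freeSymbols⁺ : ∀ {k α} (v : Vec (Fin n) k) → memB α v ≡ false → α ∈ freeSymbols v
  ∈-freeSymbols⁺ {α = α} v α∉v = ∈-filter⁺ (λ α → memB α v ≟ᵇ false) (∈-allFin α) α∉v

  freeSymbols-unique : ∀ {k} (v : Vec (Fin n) k) → Unique (freeSymbols v)
  freeSymbols-unique v = Unique.filter⁺ (λ α → memB α v ≟ᵇ false) (Unique.allFin⁺ n)

  freeSymbols-length : ∀ {k} (v : Vec (Fin n) k) → n ∸ k ≤ length (freeSymbols v)
  freeSymbols-length {k} v = begin
    n ∸ k             ≤⟨ ∸-monoʳ-≤ n used≤k ⟩
    n ∸ used          ≡⟨ cong (_∸ used) (sym used+free≡n) ⟩
    used + free ∸ used ≡⟨ m+n∸m≡n used free ⟩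
    free              ≡⟨ sym (length-filter-false (allFin n)) ⟩
    length (freeSymbols v) ∎
    where
      open ≤-Reasoning
      used = countL (λ α → memB α v) (allFin n)
      free = countL (not ∘ (λ α → memB α v)) (allFin n)

      used+free≡n : used + free ≡ n
      used+free≡n = trans (countL+countL-not (λ α → memB α v) (allFin n)) (length-tabulate id)

      used≤k : used ≤ k
      used≤k = subst (used ≤_) (trans (length-map (lookup v) (allFin k)) (length-tabulate id))
        (countL-≤-cover _≟ᶠ_ (λ α → memB α v) (map (lookup v) (allFin k)) (Unique.allFin⁺ n)
          λ α _ α∈v → let (r , vr≡α) = memB⇒lookup v α∈v in
            subst (_∈ _) vr≡α (∈-map⁺ (lookup v) (∈-allFin r)))

      length-filter-false : ∀ xs → length (filter (λ α → memB α v ≟ᵇ false) xs) ≡ countL (not ∘ (λ α → memB α v)) xs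
      length-filter-false [] = refl
      length-filter-false (x ∷ xs) with memB x v
      ... | true = length-filter-false xs
      ... | false = cong suc (length-filter-false xs)

  unswapNbrs-unique : ∀ {k} (a : Fin n) (w : Vec (Fin n) k) → Unique (unswapNbrs a w)
  unswapNbrs-unique a w = Unique.map⁺ Vecₚ.∷-injectiveˡ (freeSymbols-unique (a ∷ w))

  starNbrs-∷⁻ : ∀ {k} {a : Fin n} {w : Vec (Fin n) k} {y} → y ∈ starNbrs (a ∷ w) →
    (∃ λ j → y ≡ swapNbr a w j) ⊎ (∃ λ α → memB α (a ∷ w) ≡ false × y ≡ α ∷ w)
  starNbrs-∷⁻ {k} {a} {w} y∈ with ∈-++⁻ (swapNbrs a w) y∈
  ... | inj₁ y∈swaps = let (j , _ , y≡) = ∈-map⁻ (swapNbr a w) y∈swaps in inj₁ (j , y≡)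
  ... | inj₂ y∈unswaps = let (α , α∈ , y≡) = ∈-map⁻ (_∷ w) y∈unswaps in
    inj₂ (α , ∈-freeSymbols⁻ (a ∷ w) α∈ , y≡)

  swapNbr-∈-starNbrs : ∀ {k} (a : Fin n) (w : Vec (Fin n) k) j → swapNbr a w j ∈ starNbrs (a ∷ w)
  swapNbr-∈-starNbrs a w j = ∈-++⁺ˡ (∈-map⁺ (swapNbr a w) (∈-allFin j))

  unswap-∈-starNbrs : ∀ {k} {α : Fin n} (a : Fin n) (w : Vec (Fin n) k) →
    memB α (a ∷ w) ≡ false → (α ∷ w) ∈ starNbrs (a ∷ w)
  unswap-∈-starNbrs {k} a w α∉ = ∈-++⁺ʳ (swapNbrs a w) (∈-map⁺ (_∷ w) (∈-freeSymbols⁺ (a ∷ w) α∉))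

  Distinct-swapNbr : ∀ {k} (a : Fin n) (w : Vec (Fin n) k) j → Distinct (a ∷ w) → Distinct (swapNbr a w j)
  Distinct-swapNbr a w j d = Distinct-∷⁺ (memB-false⁺ (w [ j ]≔ a) wj-fresh) updated-distinct
    where
      a-fresh : ∀ r → lookup w r ≢ a
      a-fresh r wr≡a = 0≢1+n (d zero (suc r) (sym wr≡a))

      wj-fresh : ∀ r → lookup (w [ j ]≔ a) r ≢ lookup w j
      wj-fresh r eq with lookup-[]≔ w j a r
      ... | inj₁ (refl , upd≡a) = a-fresh j (trans (sym eq) upd≡a)
      ... | inj₂ (r≢j , upd≡wr) = r≢j (suc-injective (d (suc r) (suc j) (trans (sym upd≡wr) eq)))

      updated-distinct : Distinct (w [ j ]≔ a)
      updated-distinct r s eq with lookup-[]≔ w j a r | lookup-[]≔ w j a s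
      ... | inj₁ (refl , _) | inj₁ (refl , _) = refl
      ... | inj₁ (refl , e₁) | inj₂ (_ , e₂) = ⊥-elim (a-fresh s (sym (trans (sym e₁) (trans eq e₂))))
      ... | inj₂ (_ , e₁) | inj₁ (refl , e₂) = ⊥-elim (a-fresh r (trans (sym e₁) (trans eq e₂)))
      ... | inj₂ (_ , e₁) | inj₂ (_ , e₂) = suc-injective (d (suc r) (suc s) (trans (sym e₁) (trans eq e₂)))

  Distinct-unswap : ∀ {k} {α : Fin n} (a : Fin n) (w : Vec (Fin n) k) →
    Distinct (a ∷ w) → memB α (a ∷ w) ≡ false → Distinct (α ∷ w)
  Distinct-unswap a w d α∉ = Distinct-∷⁺ (proj₂ (memB-∷⁻ a w α∉)) (proj₂ (Distinct-∷⁻ d))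

  starNbrs-unique : ∀ {k} (v : Vec (Fin n) (suc k)) → Distinct v → Unique (starNbrs v)
  starNbrs-unique {k} (a ∷ w) d = Unique.map⁻ {f = head}
    (subst Unique (sym (map-++ head swaps unswaps)) (Unique.++⁺ swapHeads-unique unswapHeads-unique disjoint))
    where
      swaps = swapNbrs a w
      unswaps = unswapNbrs a w

      swapHeads : map head swaps ≡ map (lookup w) (allFin k)
      swapHeads = sym (map-∘ (allFin k))

      unswapHeads : map head unswaps ≡ map id (freeSymbols (a ∷ w))
      unswapHeads = sym (map-∘ (freeSymbols (a ∷ w)))

      swapHeads-unique : Unique (map head swaps)
      swapHeads-unique = subst Unique (sym swapHeads)
        (Unique.map⁺ (λ {r} {s} eq → suc-injective (d (suc r) (suc s) eq)) (Unique.allFin⁺ k))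

      unswapHeads-unique : Unique (map head unswaps)
      unswapHeads-unique = subst Unique (sym unswapHeads) (Unique.map⁺ id (freeSymbols-unique (a ∷ w)))

      disjoint : ∀ {x} → x ∈ map head swaps × x ∈ map head unswaps → ⊥
      disjoint (x∈₁ , x∈₂) with ∈-map⁻ (lookup w) (subst (_ ∈_) swapHeads x∈₁)
                             | ∈-map⁻ id (subst (_ ∈_) unswapHeads x∈₂)
      ... | r , _ , refl | β , β∈ , wr≡β = memB-false⁻ (a ∷ w) (∈-freeSymbols⁻ (a ∷ w) β∈) (suc r) wr≡β

module _ {V : Set} where

  Reach-trans : ∀ {G : Graph V} {u w v} → Reach G u w → Reach G w v → Reach G u v
  Reach-trans here r = r
  Reach-trans (step w∈ r₁) r₂ = step w∈ (Reach-trans r₁ r₂)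

  Reach-map : ∀ {W} {G : Graph V} {H : Graph W} (f : V → W) →
    (∀ {u w} → w ∈ nbrs G u → f w ∈ nbrs H (f u)) → ∀ {u v} → Reach G u v → Reach H (f u) (f v)
  Reach-map f hom here = here
  Reach-map f hom (step w∈ r) = step (hom w∈) (Reach-map f hom r)

  ∈-verts-induced⁻ : ∀ {P : V → Bool} (G : Graph V) {v} → v ∈ verts (induced P G) → v ∈ verts G × P v ≡ true
  ∈-verts-induced⁻ G = ∈-filterᵇ⁻ {xs = verts G}

  ∈-verts-induced⁺ : ∀ {P : V → Bool} (G : Graph V) {v} → v ∈ verts G → P v ≡ true → v ∈ verts (induced P G)
  ∈-verts-induced⁺ G = ∈-filterᵇ⁺

  ∈-nbrs-induced⁻ : ∀ {P : V → Bool} (G : Graph V) {u w} → w ∈ nbrs (induced P G) u → w ∈ nbrs G u × P w ≡ true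
  ∈-nbrs-induced⁻ G {u} = ∈-filterᵇ⁻ {xs = nbrs G u}

  ∈-nbrs-induced⁺ : ∀ {P : V → Bool} (G : Graph V) {u w} → w ∈ nbrs G u → P w ≡ true → w ∈ nbrs (induced P G) u
  ∈-nbrs-induced⁺ G = ∈-filterᵇ⁺

  component-splits-induced : ∀ {G : Graph V} {S X : V → Bool} (P : V → Bool) →
    IsComponent (G ─ S) X →
    any X (verts (induced P G)) ≡ true →
    any (λ v → not (S v) ∧ not (X v)) (verts (induced P G)) ≡ true →
    Disconnected (induced P G ─ S)
  component-splits-induced {G} {S} {X} P (x₀ , _ , X⇔) meetsX meetsY =
    x , y , x∈ , y∈ , x↛y
    where
      H = induced P G
      x-props = any-true⇒∃ X (verts H) meetsX
      y-props = any-true⇒∃ _ (verts H) meetsY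
      x = proj₁ x-props
      y = proj₁ y-props
      y∉S,X = ∧≡true⇒ (proj₂ (proj₂ y-props))

      x∈G-S×x₀⇝x = Equivalence.to (X⇔ x) (proj₂ (proj₂ x-props))

      x∈ : x ∈ verts (H ─ S)
      x∈ = ∈-verts-induced⁺ H (proj₁ (proj₂ x-props)) (proj₂ (∈-verts-induced⁻ G (proj₁ x∈G-S×x₀⇝x)))

      y∈ : y ∈ verts (H ─ S)
      y∈ = ∈-verts-induced⁺ H (proj₁ (proj₂ y-props)) (proj₁ y∉S,X)

      y∈G-S : y ∈ verts (G ─ S)
      y∈G-S = ∈-verts-induced⁺ G (proj₁ (∈-verts-induced⁻ G (proj₁ (proj₂ y-props)))) (proj₁ y∉S,X)

      H-S⊆G-S : ∀ {u w} → w ∈ nbrs (H ─ S) u → w ∈ nbrs (G ─ S) u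
      H-S⊆G-S w∈ = let (w∈H , w∉S) = ∈-nbrs-induced⁻ H w∈ in
        ∈-nbrs-induced⁺ G (proj₁ (∈-nbrs-induced⁻ G w∈H)) w∉S

      x↛y : ¬ Reach (H ─ S) x y
      x↛y x⇝y with () ← trans (sym (Equivalence.from (X⇔ y)
                          (y∈G-S , Reach-trans (proj₂ x∈G-S×x₀⇝x) (Reach-map id H-S⊆G-S x⇝y))))
                        (not≡true⇒≡false (proj₂ y∉S,X))

  minDeg-induced : ∀ {G : Graph V} {S : V → Bool} (P : V → Bool) {h} →
    (∀ v → v ∈ verts G → P v ≡ true → countL (not ∘ P) (nbrs G v) ≤ 1) →
    MinDegAtLeast (G ─ S) h → MinDegAtLeast (induced P G ─ S) (h ∸ 1)
  minDeg-induced {G} {S} P {h} exits≤1 minDeg v v∈ = begin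
    h ∸ 1               ≤⟨ ∸-monoˡ-≤ 1 (≤-trans h≤deg (countL≤countL-filterᵇ+countL-not (not ∘ S) P (nbrs G v))) ⟩
    inside + exits ∸ 1 ≤⟨ ∸-monoˡ-≤ 1 (+-monoʳ-≤ inside (exits≤1 v v∈G Pv)) ⟩
    inside + 1 ∸ 1     ≡⟨ m+n∸n≡m inside 1 ⟩
    inside             ∎
    where
      open ≤-Reasoning
      inside = countL (not ∘ S) (filterᵇ P (nbrs G v))
      exits = countL (not ∘ P) (nbrs G v)
      v∈H,v∉S = ∈-verts-induced⁻ (induced P G) v∈
      v∈G,Pv = ∈-verts-induced⁻ G (proj₁ v∈H,v∉S)
      v∈G = proj₁ v∈G,Pv
      Pv = proj₂ v∈G,Pv
      h≤deg : h ≤ degree (G ─ S) v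
      h≤deg = minDeg v (∈-verts-induced⁺ G v∈G (proj₂ v∈H,v∉S))

-- (a) S_i is an (h − 1)-cut of S^{t:i}

hasSymbolAt : ∀ {n k} → Fin k → Fin n → Vec (Fin n) k → Bool
hasSymbolAt t i v = does (lookup v t ≟ᶠ i)

subStar-exits≤1 : ∀ {n K} (t : Fin K) (i : Fin n) (v : Vec (Fin n) (suc K)) → Distinct v →
  lookup v (suc t) ≡ i → countL (not ∘ hasSymbolAt (suc t) i) (starNbrs v) ≤ 1
subStar-exits≤1 t i (a ∷ w) d wt≡i =
  countL-≤-cover _≟ᵛ_ _ (swapNbr a w t ∷ []) (starNbrs-unique (a ∷ w) d) exit-is-swap-t
  where
    stays : ∀ y → lookup y (suc t) ≡ i → not (hasSymbolAt (suc t) i y) ≡ true → ⊥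
    stays y yt≡i leaves with () ← trans (sym (dec-true (_ ≟ᶠ i) yt≡i)) (not≡true⇒≡false leaves)

    exit-is-swap-t : ∀ y → y ∈ starNbrs (a ∷ w) → not (hasSymbolAt (suc t) i y) ≡ true → y ∈ swapNbr a w t ∷ []
    exit-is-swap-t y y∈ leaves with starNbrs-∷⁻ y∈
    ... | inj₂ (α , _ , refl) = ⊥-elim (stays (α ∷ w) wt≡i leaves)
    ... | inj₁ (j , refl) with t ≟ᶠ j
    ...   | yes refl = here refl
    ...   | no t≢j = ⊥-elim (stays (swapNbr a w j) (trans (Vecₚ.lookup∘update′ t≢j w a) wt≡i) leaves)

subStar-hCut : ∀ {n K h} (S X : Vec (Fin n) (suc K) → Bool) (t : Fin K) (i : Fin n) →
  IsHCut h (Star n (suc K)) S → IsComponent (Star n (suc K) ─ S) X →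
  J'set n (suc K) (suc t) S X i ≡ true → IsHCut (h ∸ 1) (StarSub n (suc K) (suc t) i) S
subStar-hCut {n} {K} S X t i (_ , minDeg) comp i∈J' =
  component-splits-induced {G = Star n (suc K)} {S} (hasSymbolAt (suc t) i) comp
    (proj₁ (∧≡true⇒ i∈J')) (proj₂ (∧≡true⇒ i∈J')) ,
  minDeg-induced {G = Star n (suc K)} {S} (hasSymbolAt (suc t) i) exits≤1 minDeg
  where
    exits≤1 : ∀ v → v ∈ perms n (suc K) → hasSymbolAt (suc t) i v ≡ true →
              countL (not ∘ hasSymbolAt (suc t) i) (starNbrs v) ≤ 1
    exits≤1 v v∈ vt≡i = subStar-exits≤1 t i v (∈-perms⁻ v∈) (does≡true⇒≡ vt≡i)

-- (b) Transfer along S^{t:i} ≅ S_{n−1,k−1}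

record IsGraphIsomorphism {V W : Set} (G : Graph V) (H : Graph W) (ψ : V → W) : Set where
  field
    injective : ∀ {u v} → ψ u ≡ ψ v → u ≡ v
    verts⁺ : ∀ {v} → v ∈ verts G → ψ v ∈ verts H
    verts⁻ : ∀ {x} → x ∈ verts H → ∃ λ v → v ∈ verts G × ψ v ≡ x
    nbrs⁺ : ∀ {u w} → w ∈ nbrs G u → ψ w ∈ nbrs H (ψ u)
    nbrs⁻ : ∀ {u y} → y ∈ nbrs H (ψ u) → ∃ λ w → w ∈ nbrs G u × ψ w ≡ y

module _ {V W : Set} {G : Graph V} {H : Graph W} {ψ : V → W} (iso : IsGraphIsomorphism G H ψ)
         (_≟_ : DecidableEquality W) (S : W → Bool) where
  open IsGraphIsomorphism iso

  private
    verts⁻-─ : ∀ {x} → x ∈ verts (H ─ S) → ∃ λ v → v ∈ verts (G ─ (S ∘ ψ)) × ψ v ≡ x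
    verts⁻-─ x∈ with ∈-verts-induced⁻ H x∈
    ... | x∈H , x∉S with verts⁻ x∈H
    ...   | v , v∈G , refl = v , ∈-verts-induced⁺ G v∈G x∉S , refl

    nbrs⁺-─ : ∀ {u w} → w ∈ nbrs (G ─ (S ∘ ψ)) u → ψ w ∈ nbrs (H ─ S) (ψ u)
    nbrs⁺-─ w∈ = let (w∈G , w∉S) = ∈-nbrs-induced⁻ G w∈ in ∈-nbrs-induced⁺ H (nbrs⁺ w∈G) w∉S

  IsHCut-pullback : ∀ {h} → (∀ x → x ∈ verts H → Unique (nbrs H x)) → IsHCut h H S → IsHCut h G (S ∘ ψ)
  IsHCut-pullback {h} nbrs-unique ((x , y , x∈ , y∈ , x↛y) , minDeg) = disconnected , minDeg′
    where
      disconnected : Disconnected (G ─ (S ∘ ψ))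
      disconnected with verts⁻-─ x∈ | verts⁻-─ y∈
      ... | u , u∈ , refl | v , v∈ , refl = u , v , u∈ , v∈ , λ u⇝v → x↛y (Reach-map ψ nbrs⁺-─ u⇝v)

      minDeg′ : MinDegAtLeast (G ─ (S ∘ ψ)) h
      minDeg′ v v∈ = ≤-trans (minDeg (ψ v) ψv∈) (subst (degree (H ─ S) (ψ v) ≤_)
        (length-map ψ (nbrs (G ─ (S ∘ ψ)) v)) (unique⊆⇒length≤ _≟_ nbrs-H-S-unique pulled-back))
        where
          v∈G,v∉S = ∈-verts-induced⁻ G v∈
          ψv∈H = verts⁺ (proj₁ v∈G,v∉S)
          ψv∈ : ψ v ∈ verts (H ─ S)
          ψv∈ = ∈-verts-induced⁺ H ψv∈H (proj₂ v∈G,v∉S)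

          nbrs-H-S-unique : Unique (nbrs (H ─ S) (ψ v))
          nbrs-H-S-unique = filterᵇ-unique (not ∘ S) (nbrs-unique (ψ v) ψv∈H)

          pulled-back : nbrs (H ─ S) (ψ v) ⊆ map ψ (nbrs (G ─ (S ∘ ψ)) v)
          pulled-back y∈ with ∈-nbrs-induced⁻ H y∈
          ... | y∈H , y∉S with nbrs⁻ y∈H
          ...   | w , w∈G , refl = ∈-map⁺ ψ (∈-nbrs-induced⁺ G w∈G y∉S)

  card-pullback : Unique (verts G) → card G (S ∘ ψ) ≤ card H S
  card-pullback verts-unique = subst (_≤ card H S) (length-map ψ (filterᵇ (S ∘ ψ) (verts G)))
    (unique⊆⇒length≤ _≟_ (Unique.map⁺ injective (filterᵇ-unique (S ∘ ψ) verts-unique)) pushed-forward)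
    where
      pushed-forward : map ψ (filterᵇ (S ∘ ψ) (verts G)) ⊆ filterᵇ S (verts H)
      pushed-forward x∈ with ∈-map⁻ ψ x∈
      ... | v , v∈ , refl = let (v∈G , Sψv) = ∈-filterᵇ⁻ {P = S ∘ ψ} v∈ in ∈-filterᵇ⁺ (verts⁺ v∈G) Sψv

punchIn-view : ∀ {K} (t r : Fin (suc K)) → r ≡ t ⊎ ∃ λ z → r ≡ punchIn t z
punchIn-view t r with t ≟ᶠ r
... | yes t≡r = inj₁ (sym t≡r)
... | no t≢r = inj₂ (punchOut t≢r , sym (punchIn-punchOut t≢r))

insertAt-[]≔ : ∀ {A : Set} {m} (xs : Vec A m) (t : Fin (suc m)) (j : Fin m) (y v : A) →
  insertAt (xs [ j ]≔ y) t v ≡ insertAt xs t v [ punchIn t j ]≔ y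
insertAt-[]≔ xs zero j y v = refl
insertAt-[]≔ (x ∷ xs) (suc t) zero y v = refl
insertAt-[]≔ (x ∷ xs) (suc t) (suc j) y v = cong (x ∷_) (insertAt-[]≔ xs t j y v)

-- S^{t:i}_{n,k} ≅ S_{n-1,k-1}: relabel the symbols to avoid i, then insert i at position t.
module SubStar {N K : ℕ} (t : Fin (suc K)) (i : Fin (suc N)) where

  toSubStar : Vec (Fin N) (suc K) → Vec (Fin (suc N)) (suc (suc K))
  toSubStar w = insertAt (mapᵛ (punchIn i) w) (suc t) i

  lookup-toSubStar-t : ∀ w → lookup (toSubStar w) (suc t) ≡ i
  lookup-toSubStar-t w = Vecₚ.insertAt-lookup (mapᵛ (punchIn i) w) (suc t) i

  lookup-toSubStar-punchIn : ∀ w z → lookup (toSubStar w) (punchIn (suc t) z) ≡ punchIn i (lookup w z)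
  lookup-toSubStar-punchIn w z =
    trans (Vecₚ.insertAt-punchIn (mapᵛ (punchIn i) w) (suc t) i z) (Vecₚ.lookup-map z (punchIn i) w)

  toSubStar-injective : ∀ {u v} → toSubStar u ≡ toSubStar v → u ≡ v
  toSubStar-injective {u} {v} eq = ≗-lookup⇒≡ u v λ z → punchIn-injective i _ _
    (trans (sym (lookup-toSubStar-punchIn u z))
      (trans (cong (λ x → lookup x (punchIn (suc t) z)) eq) (lookup-toSubStar-punchIn v z)))

  Distinct-toSubStar⁺ : ∀ w → Distinct w → Distinct (toSubStar w)
  Distinct-toSubStar⁺ w d r s eq with punchIn-view (suc t) r | punchIn-view (suc t) s
  ... | inj₁ refl | inj₁ refl = refl
  ... | inj₁ refl | inj₂ (z , refl) =
    ⊥-elim (punchInᵢ≢i i _ (sym (trans (sym (lookup-toSubStar-t w)) (trans eq (lookup-toSubStar-punchIn w z)))))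
  ... | inj₂ (z , refl) | inj₁ refl =
    ⊥-elim (punchInᵢ≢i i _ (trans (sym (lookup-toSubStar-punchIn w z)) (trans eq (lookup-toSubStar-t w))))
  ... | inj₂ (z₁ , refl) | inj₂ (z₂ , refl) = cong (punchIn (suc t)) (d z₁ z₂ (punchIn-injective i _ _
    (trans (sym (lookup-toSubStar-punchIn w z₁)) (trans eq (lookup-toSubStar-punchIn w z₂)))))

  Distinct-toSubStar⁻ : ∀ w → Distinct (toSubStar w) → Distinct w
  Distinct-toSubStar⁻ w d z₁ z₂ eq = punchIn-injective (suc t) z₁ z₂ (d _ _
    (trans (lookup-toSubStar-punchIn w z₁) (trans (cong (punchIn i) eq) (sym (lookup-toSubStar-punchIn w z₂)))))

  toSubStar-surjective : ∀ x → Distinct x → lookup x (suc t) ≡ i → ∃ λ w → toSubStar w ≡ x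
  toSubStar-surjective x d xt≡i = w , ≗-lookup⇒≡ (toSubStar w) x agree
    where
      i-elsewhere : ∀ z → i ≢ lookup x (punchIn (suc t) z)
      i-elsewhere z eq = punchInᵢ≢i (suc t) z (sym (d _ _ (trans xt≡i eq)))

      w : Vec (Fin N) (suc K)
      w = tabulate λ z → punchOut (i-elsewhere z)

      agree : ∀ r → lookup (toSubStar w) r ≡ lookup x r
      agree r with punchIn-view (suc t) r
      ... | inj₁ refl = trans (lookup-toSubStar-t w) (sym xt≡i)
      ... | inj₂ (z , refl) = trans (lookup-toSubStar-punchIn w z)
        (trans (cong (punchIn i) (Vecₚ.lookup∘tabulate (λ z → punchOut (i-elsewhere z)) z)) (punchIn-punchOut (i-elsewhere z)))

  toSubStar-swapNbr : ∀ c r j → toSubStar (swapNbr c r j) ≡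
    swapNbr (punchIn i c) (insertAt (mapᵛ (punchIn i) r) t i) (punchIn t j)
  toSubStar-swapNbr c r j = cong₂ _∷_
    (sym (trans (Vecₚ.insertAt-punchIn (mapᵛ (punchIn i) r) t i j) (Vecₚ.lookup-map j (punchIn i) r)))
    (trans (cong (λ z → insertAt z t i) (Vecₚ.map-[]≔ (punchIn i) r j)) (insertAt-[]≔ (mapᵛ (punchIn i) r) t j (punchIn i c) i))

  memB-toSubStar : ∀ {α} w → memB α w ≡ false → memB (punchIn i α) (toSubStar w) ≡ false
  memB-toSubStar {α} w α∉w = memB-false⁺ (toSubStar w) absent
    where
      absent : ∀ r → lookup (toSubStar w) r ≢ punchIn i α
      absent r eq with punchIn-view (suc t) r
      ... | inj₁ refl = punchInᵢ≢i i α (sym (trans (sym (lookup-toSubStar-t w)) eq))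
      ... | inj₂ (z , refl) = memB-false⁻ w α∉w z
        (punchIn-injective i _ _ (trans (sym (lookup-toSubStar-punchIn w z)) eq))

  toSubStar-starNbrs⁺ : ∀ {u w} → w ∈ starNbrs u → toSubStar w ∈ starNbrs (toSubStar u)
  toSubStar-starNbrs⁺ {c ∷ r} w∈ with starNbrs-∷⁻ w∈
  ... | inj₁ (j , refl) = subst (_∈ starNbrs (toSubStar (c ∷ r))) (sym (toSubStar-swapNbr c r j))
    (swapNbr-∈-starNbrs (punchIn i c) _ (punchIn t j))
  ... | inj₂ (α , α∉ , refl) = unswap-∈-starNbrs (punchIn i c) _ (memB-toSubStar (c ∷ r) α∉)

  toSubStar-starNbrs⁻ : ∀ {u y} → y ∈ starNbrs (toSubStar u) → lookup y (suc t) ≡ i →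
    ∃ λ w → w ∈ starNbrs u × toSubStar w ≡ y
  toSubStar-starNbrs⁻ {c ∷ r} y∈ yt≡i with starNbrs-∷⁻ y∈
  ... | inj₁ (j , refl) with punchIn-view t j
  ...   | inj₁ refl = ⊥-elim (punchInᵢ≢i i c
    (trans (sym (Vecₚ.lookup∘update t (insertAt (mapᵛ (punchIn i) r) t i) (punchIn i c))) yt≡i))
  ...   | inj₂ (z , refl) = swapNbr c r z , swapNbr-∈-starNbrs c r z , toSubStar-swapNbr c r z
  toSubStar-starNbrs⁻ {c ∷ r} y∈ yt≡i | inj₂ (α , α∉ , refl) =
    β ∷ r , unswap-∈-starNbrs c r β∉ , cong (_∷ _) (punchIn-punchOut i≢α)
    where
      i≢α : i ≢ α
      i≢α i≡α = memB-false⁻ (toSubStar (c ∷ r)) α∉ (suc t) (trans (lookup-toSubStar-t (c ∷ r)) i≡α)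
      β = punchOut i≢α
      β∉ : memB β (c ∷ r) ≡ false
      β∉ = memB-false⁺ (c ∷ r) λ z cr-z≡β → memB-false⁻ (toSubStar (c ∷ r)) α∉ (punchIn (suc t) z)
        (trans (lookup-toSubStar-punchIn (c ∷ r) z) (trans (cong (punchIn i) cr-z≡β) (punchIn-punchOut i≢α)))

  Sub : Graph (Vec (Fin (suc N)) (suc (suc K)))
  Sub = StarSub (suc N) (suc (suc K)) (suc t) i

  toSubStar-iso : IsGraphIsomorphism (Star N (suc K)) Sub toSubStar
  toSubStar-iso = record
    { injective = toSubStar-injective
    ; verts⁺ = λ {w} w∈ → ∈-verts-induced⁺ {P = hasSymbolAt (suc t) i} (Star (suc N) (suc (suc K)))
        (∈-perms⁺ (Distinct-toSubStar⁺ w (∈-perms⁻ w∈))) (dec-true (_ ≟ᶠ i) (lookup-toSubStar-t w))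
    ; verts⁻ = verts⁻
    ; nbrs⁺ = λ {u} {w} w∈ → ∈-nbrs-induced⁺ {P = hasSymbolAt (suc t) i} (Star (suc N) (suc (suc K))) {toSubStar u}
        (toSubStar-starNbrs⁺ {u} w∈) (dec-true (_ ≟ᶠ i) (lookup-toSubStar-t w))
    ; nbrs⁻ = λ {u} y∈ →
        let (y∈Star , yt≡i) = ∈-nbrs-induced⁻ {P = hasSymbolAt (suc t) i} (Star (suc N) (suc (suc K))) {toSubStar u} y∈
        in toSubStar-starNbrs⁻ {u} y∈Star (does≡true⇒≡ yt≡i)
    }
    where
      verts⁻ : ∀ {x} → x ∈ verts Sub → ∃ λ w → w ∈ perms N (suc K) × toSubStar w ≡ x
      verts⁻ {x} x∈ with ∈-verts-induced⁻ (Star (suc N) (suc (suc K))) x∈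
      ... | x∈Star , xt≡i with toSubStar-surjective x (∈-perms⁻ x∈Star) (does≡true⇒≡ xt≡i)
      ...   | w , refl = w , ∈-perms⁺ (Distinct-toSubStar⁻ w (∈-perms⁻ x∈Star)) , refl

  Sub-nbrs-unique : ∀ x → x ∈ verts Sub → Unique (nbrs Sub x)
  Sub-nbrs-unique x x∈ = filterᵇ-unique (hasSymbolAt (suc t) i)
    (starNbrs-unique x (∈-perms⁻ (proj₁ (∈-verts-induced⁻ (Star (suc N) (suc (suc K))) x∈))))

  κ≤card-subStar-cut : ∀ {h m S} → IsKappa h (Star N (suc K)) m → IsHCut h Sub S → m ≤ card Sub S
  κ≤card-subStar-cut {S = S} (_ , κ-min) S-cut = ≤-trans
    (κ-min (S ∘ toSubStar) (IsHCut-pullback toSubStar-iso _≟ᵛ_ S Sub-nbrs-unique S-cut))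
    (card-pullback toSubStar-iso _≟ᵛ_ S (perms-unique (suc K)))

length-concatMap-≥ : ∀ {A B : Set} (f : B → List A) m bs → (∀ b → b ∈ bs → m ≤ length (f b)) →
  length bs * m ≤ length (concatMap f bs)
length-concatMap-≥ f m [] _ = z≤n
length-concatMap-≥ f m (b ∷ bs) large = subst (m + length bs * m ≤_) (sym (length-++ (f b)))
  (+-mono-≤ (large b (here refl)) (length-concatMap-≥ f m bs λ b′ b′∈ → large b′ (there b′∈)))

classes-count-≤ : ∀ {A : Set} {n m} → DecidableEquality A → (c : A → Fin n) (S : A → Bool) {xs : List A} (I : List (Fin n)) →
  Unique xs → Unique I → (∀ i → i ∈ I → m ≤ countL S (filterᵇ (λ v → does (c v ≟ᶠ i)) xs)) →
  length I * m ≤ countL S xs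
classes-count-≤ {m = m} _≟_ c S {xs} I xs-unique I-unique large = ≤-trans
  (length-concatMap-≥ block m I large)
  (unique⊆⇒length≤ _≟_ (unique-concatMap block I-unique block-unique same-class) blocks⊆S)
  where
    block : Fin _ → List _
    block i = filterᵇ S (filterᵇ (λ v → does (c v ≟ᶠ i)) xs)

    ∈-block⁻ : ∀ {i x} → x ∈ block i → x ∈ xs × c x ≡ i × S x ≡ true
    ∈-block⁻ {i} x∈ = let (x∈class , Sx) = ∈-filterᵇ⁻ {P = S} x∈
                          (x∈xs , cx≡i) = ∈-filterᵇ⁻ {xs = xs} x∈class
                      in x∈xs , does≡true⇒≡ cx≡i , Sx

    block-unique : ∀ i → Unique (block i)
    block-unique i = filterᵇ-unique S (filterᵇ-unique _ xs-unique)

    same-class : ∀ {i j x} → x ∈ block i → x ∈ block j → i ≡ j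
    same-class x∈i x∈j = trans (sym (proj₁ (proj₂ (∈-block⁻ x∈i)))) (proj₁ (proj₂ (∈-block⁻ x∈j)))

    blocks⊆S : concatMap block I ⊆ filterᵇ S xs
    blocks⊆S x∈ with satisfied (∈-concatMap⁻ block {xs = I} x∈)
    ... | i , x∈i = let (x∈xs , _ , Sx) = ∈-block⁻ {i} x∈i in ∈-filterᵇ⁺ x∈xs Sx

-- (c) A minimum h-cut contains no whole S^{t:i}

-- The swap-neighbourhood of the class {α q : α ∉ q} of mutually unswap-adjacent vertices.
module Boundary {n K : ℕ} (q : Vec (Fin n) K) where

  open import Data.List.Membership.DecPropositional (_≟ᵛ_ {n} {suc K}) using (_∈?_)

  boundary : List (Vec (Fin n) (suc K))
  boundary = concatMap (λ α → swapNbrs α q) (freeSymbols q)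

  inBoundary : Vec (Fin n) (suc K) → Bool
  inBoundary v = does (v ∈? boundary)

  inBoundary⁻ : ∀ {v} → inBoundary v ≡ true → ∃ λ α → ∃ λ j → memB α q ≡ false × v ≡ swapNbr α q j
  inBoundary⁻ {v} v∈ with v ∈? boundary
  ... | yes v∈boundary with find (∈-concatMap⁻ (λ α → map (swapNbr α q) (allFin K)) {xs = freeSymbols q} v∈boundary)
  ...   | α , α∈ , v∈swaps = let (j , _ , v≡) = ∈-map⁻ (swapNbr α q) v∈swaps in α , j , ∈-freeSymbols⁻ q α∈ , v≡

  swapNbr-inBoundary : ∀ {α} j → memB α q ≡ false → inBoundary (swapNbr α q j) ≡ true
  swapNbr-inBoundary {α} j α∉q = dec-true (_ ∈? boundary)
    (∈-concatMap⁺ (λ α → map (swapNbr α q) (allFin K)) {xs = freeSymbols q}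
      (Any.map (λ { refl → ∈-map⁺ (swapNbr α q) (∈-allFin j) }) (∈-freeSymbols⁺ q α∉q)))

  freshHead⇒∉boundary : ∀ v → memB (head v) q ≡ false → inBoundary v ≡ false
  freshHead⇒∉boundary v head∉q with inBoundary v in v∈
  ... | false = refl
  ... | true with inBoundary⁻ {v} v∈
  ...   | α , j , _ , refl with () ← trans (sym (lookup⇒memB q j refl)) head∉q

  boundary-head-unique : ∀ {b₁ b₂ s} → inBoundary (b₁ ∷ s) ≡ true → inBoundary (b₂ ∷ s) ≡ true → b₁ ≡ b₂
  boundary-head-unique {b₁} {b₂} {s} b₁s∈ b₂s∈ with inBoundary⁻ {b₁ ∷ s} b₁s∈ | inBoundary⁻ {b₂ ∷ s} b₂s∈
  ... | α₁ , j₁ , α₁∉q , e₁ | α₂ , j₂ , _ , e₂ with j₁ ≟ᶠ j₂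
  ...   | yes refl = trans (Vecₚ.∷-injectiveˡ e₁) (sym (Vecₚ.∷-injectiveˡ e₂))
  ...   | no j₁≢j₂ = ⊥-elim (memB-false⁻ q α₁∉q j₁ (begin
    lookup q j₁                ≡⟨ sym (Vecₚ.lookup∘update′ j₁≢j₂ q α₂) ⟩
    lookup (q [ j₂ ]≔ α₂) j₁   ≡⟨ cong (λ w → lookup w j₁) (trans (sym (Vecₚ.∷-injectiveʳ e₂))
                                                                     (Vecₚ.∷-injectiveʳ e₁)) ⟩
    lookup (q [ j₁ ]≔ α₁) j₁   ≡⟨ Vecₚ.lookup∘update j₁ q α₁ ⟩
    α₁                         ∎))
    where open ≡-Reasoning

  private
    G = Star n (suc K)

  InClass : Vec (Fin n) (suc K) → Set
  InClass x = tail x ≡ q × memB (head x) q ≡ false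

  InClass-step : ∀ {x y} → y ∈ nbrs (G ─ inBoundary) x → InClass x → InClass y
  InClass-step {c ∷ _} y∈ (refl , c∉q) with ∈-nbrs-induced⁻ G y∈
  ... | y∈G , y∉∂ with starNbrs-∷⁻ y∈G
  ...   | inj₁ (j , refl) with () ← trans (sym (swapNbr-inBoundary j c∉q)) (not≡true⇒≡false y∉∂)
  ...   | inj₂ (α , α∉ , refl) = refl , proj₂ (memB-∷⁻ c q α∉)

  InClass-Reach : ∀ {x y} → Reach (G ─ inBoundary) x y → InClass x → InClass y
  InClass-Reach here x∈C = x∈C
  InClass-Reach {x} (step w∈ r) x∈C = InClass-Reach r (InClass-step {x} w∈ x∈C)

  boundary-disconnects : ∀ {α₀} (v : Vec (Fin n) (suc K)) → Distinct q → memB α₀ q ≡ false →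
    Distinct v → memB (head v) q ≡ false → tail v ≢ q → Disconnected (G ─ inBoundary)
  boundary-disconnects {α₀} v q-distinct α₀∉q v-distinct head∉q tail≢q =
    α₀ ∷ q , v ,
    ∈-verts-induced⁺ G (∈-perms⁺ (Distinct-∷⁺ α₀∉q q-distinct))
      (≡false⇒not≡true (freshHead⇒∉boundary (α₀ ∷ q) α₀∉q)) ,
    ∈-verts-induced⁺ G (∈-perms⁺ v-distinct) (≡false⇒not≡true (freshHead⇒∉boundary v head∉q)) ,
    λ r → tail≢q (proj₁ (InClass-Reach r (refl , α₀∉q)))

  -- At most one unswap-neighbour of c s lies in the boundary, and if one does then
  -- s = q[j ≔ α] and the swap-neighbour at j, with head α ∉ q, lies outside it.
  boundary-unswapNbrs≤ : ∀ c s → countL inBoundary (unswapNbrs c s) ≤ countL (not ∘ inBoundary) (swapNbrs c s)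
  boundary-unswapNbrs≤ c s with any? (λ b → inBoundary (b ∷ s) ≟ᵇ true) (freeSymbols (c ∷ s))
  ... | no none = ≤-trans (countL-≤-cover _≟ᵛ_ inBoundary [] (unswapNbrs-unique c s) none-in-boundary) z≤n
    where
      none-in-boundary : ∀ y → y ∈ unswapNbrs c s → inBoundary y ≡ true → y ∈ []
      none-in-boundary y y∈ y∈∂ with ∈-map⁻ (_∷ s) y∈
      ... | b , b∈ , refl = ⊥-elim (none (Any.map (λ { refl → y∈∂ }) b∈))
  ... | yes some with find some
  ...   | b₀ , _ , b₀s∈∂ with inBoundary⁻ {b₀ ∷ s} b₀s∈∂
  ...     | α , j , α∉q , e = ≤-trans in∂≤1 swap-j-outside
    where
      in∂≤1 : countL inBoundary (unswapNbrs c s) ≤ 1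
      in∂≤1 = countL-≤-cover _≟ᵛ_ inBoundary ((b₀ ∷ s) ∷ []) (unswapNbrs-unique c s)
        λ y y∈ y∈∂ → case ∈-map⁻ (_∷ s) y∈ of λ where
          (b , _ , refl) → here (cong (_∷ s) (boundary-head-unique {b} {b₀} y∈∂ b₀s∈∂))

      sj≡α : lookup s j ≡ α
      sj≡α = trans (cong (λ w → lookup w j) (Vecₚ.∷-injectiveʳ e)) (Vecₚ.lookup∘update j q α)

      swap-j-outside : 1 ≤ countL (not ∘ inBoundary) (swapNbrs c s)
      swap-j-outside = countL-pos (not ∘ inBoundary) (swapNbrs c s) (∈-map⁺ (swapNbr c s) (∈-allFin j))
        (≡false⇒not≡true (freshHead⇒∉boundary (swapNbr c s j) (subst (λ a → memB a q ≡ false) (sym sj≡α) α∉q)))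

  freeSymbols≤degree : ∀ c s → length (freeSymbols (c ∷ s)) ≤ countL (not ∘ inBoundary) (starNbrs (c ∷ s))
  freeSymbols≤degree c s = begin
    length (freeSymbols (c ∷ s))  ≡⟨ sym (length-map (_∷ s) (freeSymbols (c ∷ s))) ⟩
    length (unswapNbrs c s)       ≡⟨ sym (countL+countL-not inBoundary (unswapNbrs c s)) ⟩
    countL inBoundary (unswapNbrs c s) + countL (not ∘ inBoundary) (unswapNbrs c s)
      ≤⟨ +-monoˡ-≤ _ (boundary-unswapNbrs≤ c s) ⟩
    countL (not ∘ inBoundary) (swapNbrs c s) + countL (not ∘ inBoundary) (unswapNbrs c s)
      ≡⟨ sym (countL-++ (not ∘ inBoundary) (swapNbrs c s) (unswapNbrs c s)) ⟩
    countL (not ∘ inBoundary) (starNbrs (c ∷ s)) ∎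
    where open ≤-Reasoning

  boundary-minDeg : ∀ {h} → h ≤ n ∸ suc K → MinDegAtLeast (G ─ inBoundary) h
  boundary-minDeg h≤ (c ∷ s) _ = ≤-trans h≤ (≤-trans (freeSymbols-length (c ∷ s)) (freeSymbols≤degree c s))

  module _ (t : Fin K) {i : Fin n} (qt≡i : lookup q t ≡ i) where

    private
      Z = hasSymbolAt (suc t) i
      Perms = perms n (suc K)
      swapsAt-t = map (λ α → swapNbr α q t) (freeSymbols q)

    boundary∖subStar≤ : countL (λ v → inBoundary v ∧ not (Z v)) Perms ≤ length (freeSymbols q)
    boundary∖subStar≤ = subst (countL (λ v → inBoundary v ∧ not (Z v)) Perms ≤_)
      (length-map (λ α → swapNbr α q t) (freeSymbols q))
      (countL-≤-cover _≟ᵛ_ _ swapsAt-t (perms-unique (suc K)) swap-at-t)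
      where
        swap-at-t : ∀ v → v ∈ Perms → inBoundary v ∧ not (Z v) ≡ true → v ∈ swapsAt-t
        swap-at-t v _ v∈∂∖Z with ∧≡true⇒ {inBoundary v} v∈∂∖Z
        ... | v∈∂ , v∉Z with inBoundary⁻ {v} v∈∂
        ...   | α , j , α∉q , refl with j ≟ᶠ t
        ...     | yes refl = ∈-map⁺ (λ α → swapNbr α q t) (∈-freeSymbols⁺ q α∉q)
        ...     | no j≢t with () ← trans (sym (dec-true (_ ≟ᶠ i) (trans (Vecₚ.lookup∘update′ (j≢t ∘ sym) q α) qt≡i)))
                                        (not≡true⇒≡false v∉Z)

    subStar-large : ∀ (v : Vec (Fin n) (suc K)) → Distinct q → Distinct v → Z v ≡ true →
      memB (head v) q ≡ false → tail v ≢ q →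
      countL (λ v → inBoundary v ∧ Z v) Perms + suc (length (freeSymbols q)) ≤ countL Z Perms
    subStar-large v q-distinct v-distinct Zv head∉q tail≢q =
      subst (_≤ countL Z Perms) length-L (unique⊆⇒length≤ _≟ᵛ_ L-unique L⊆Z)
      where
        ∂Z = filterᵇ (λ v → inBoundary v ∧ Z v) Perms
        class = map (_∷ q) (freeSymbols q)
        L = ∂Z ++ class ++ v ∷ []

        ∈-∂Z⁻ : ∀ {x} → x ∈ ∂Z → x ∈ Perms × inBoundary x ≡ true × Z x ≡ true
        ∈-∂Z⁻ {x} x∈ = let (x∈Perms , x∈∂∧Z) = ∈-filterᵇ⁻ {P = λ v → inBoundary v ∧ Z v} {xs = Perms} x∈ in
          x∈Perms , ∧≡true⇒ {inBoundary x} x∈∂∧Z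

        length-L : length L ≡ length ∂Z + suc (length (freeSymbols q))
        length-L = begin
          length L                                  ≡⟨ length-++ ∂Z ⟩
          length ∂Z + length (class ++ v ∷ [])      ≡⟨ cong (length ∂Z +_) (length-++ class) ⟩
          length ∂Z + (length class + 1)            ≡⟨ cong (λ m → length ∂Z + (m + 1)) (length-map (_∷ q) (freeSymbols q)) ⟩
          length ∂Z + (length (freeSymbols q) + 1)  ≡⟨ cong (length ∂Z +_) (+-comm _ 1) ⟩
          length ∂Z + suc (length (freeSymbols q))  ∎
          where open ≡-Reasoning

        class∌v : ∀ {x} → x ∈ class × x ∈ v ∷ [] → ⊥
        class∌v (x∈ , here refl) with ∈-map⁻ (_∷ q) x∈
        ... | _ , _ , refl = tail≢q refl

        ∂Z∌rest : ∀ {x} → x ∈ ∂Z × x ∈ class ++ v ∷ [] → ⊥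
        ∂Z∌rest (x∈∂Z , x∈rest) with proj₁ (proj₂ (∈-∂Z⁻ x∈∂Z)) | ∈-++⁻ class x∈rest
        ... | x∈∂ | inj₁ x∈class with ∈-map⁻ (_∷ q) x∈class
        ...   | α , α∈ , refl with () ← trans (sym x∈∂) (freshHead⇒∉boundary (α ∷ q) (∈-freeSymbols⁻ q α∈))
        ∂Z∌rest _ | x∈∂ | inj₂ (here refl) with () ← trans (sym x∈∂) (freshHead⇒∉boundary v head∉q)

        L-unique : Unique L
        L-unique = Unique.++⁺ (filterᵇ-unique _ (perms-unique (suc K)))
          (Unique.++⁺ (Unique.map⁺ Vecₚ.∷-injectiveˡ (freeSymbols-unique q)) ([] ∷ []) class∌v) ∂Z∌rest

        L⊆Z : L ⊆ filterᵇ Z Perms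
        L⊆Z x∈ with ∈-++⁻ ∂Z x∈
        ... | inj₁ x∈∂Z = let (x∈Perms , _ , Zx) = ∈-∂Z⁻ x∈∂Z in ∈-filterᵇ⁺ {P = Z} x∈Perms Zx
        ... | inj₂ x∈rest with ∈-++⁻ class x∈rest
        ...   | inj₁ x∈class with ∈-map⁻ (_∷ q) x∈class
        ...     | α , α∈ , refl = ∈-filterᵇ⁺ {P = Z} (∈-perms⁺ (Distinct-∷⁺ (∈-freeSymbols⁻ q α∈) q-distinct))
                                    (dec-true (_ ≟ᶠ i) qt≡i)
        L⊆Z x∈ | inj₂ _ | inj₂ (here refl) = ∈-filterᵇ⁺ {P = Z} (∈-perms⁺ v-distinct) Zv

    minCut-⊉-subStar : ∀ {h α₀ β} (j : Fin K) → t ≢ j → h ≤ n ∸ suc K → Distinct q →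
      memB α₀ q ≡ false → memB β (α₀ ∷ q) ≡ false → (S : Vec (Fin n) (suc K) → Bool) →
      (∀ S′ → IsHCut h G S′ → card G S ≤ card G S′) →
      ¬ (∀ v → v ∈ Perms → Z v ≡ true → S v ≡ true)
    minCut-⊉-subStar {h} {α₀} {β} j t≢j h≤ q-distinct α₀∉q β∉ S minimal Z⊆S =
      1+n≰n (+-cancelˡ-≤ a (suc f) f (begin
        a + suc f          ≤⟨ subStar-large v* q-distinct v*-distinct Zv* β∉q tail≢q ⟩
        countL Z Perms      ≤⟨ countL-mono Z S Perms Z⊆S ⟩
        card G S           ≤⟨ minimal inBoundary boundary-cut ⟩
        card G inBoundary  ≡⟨ countL-∧-split inBoundary Z Perms ⟩
        a + countL (λ v → inBoundary v ∧ not (Z v)) Perms ≤⟨ +-monoʳ-≤ a boundary∖subStar≤ ⟩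
        a + f              ∎))
      where
        open ≤-Reasoning
        a = countL (λ v → inBoundary v ∧ Z v) Perms
        f = length (freeSymbols q)

        β≢α₀,β∉q = memB-∷⁻ α₀ q β∉
        β∉q = proj₂ β≢α₀,β∉q

        v* : Vec (Fin n) (suc K)
        v* = β ∷ (q [ j ]≔ α₀)

        v*-distinct : Distinct v*
        v*-distinct = Distinct-∷⁺ (memB-false⁺ (q [ j ]≔ α₀) β-absent)
          (proj₂ (Distinct-∷⁻ (Distinct-swapNbr α₀ q j (Distinct-∷⁺ α₀∉q q-distinct))))
          where
            β-absent : ∀ r → lookup (q [ j ]≔ α₀) r ≢ β
            β-absent r eq with lookup-[]≔ q j α₀ r
            ... | inj₁ (_ , upd≡α₀) = proj₁ β≢α₀,β∉q (trans (sym eq) upd≡α₀)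
            ... | inj₂ (_ , upd≡qr) = memB-false⁻ q β∉q r (trans (sym upd≡qr) eq)

        Zv* : Z v* ≡ true
        Zv* = dec-true (_ ≟ᶠ i) (trans (Vecₚ.lookup∘update′ t≢j q α₀) qt≡i)

        tail≢q : q [ j ]≔ α₀ ≢ q
        tail≢q eq = memB-false⁻ q α₀∉q j (trans (cong (λ w → lookup w j) (sym eq)) (Vecₚ.lookup∘update j q α₀))

        boundary-cut : IsHCut h G inBoundary
        boundary-cut = boundary-disconnects v* q-distinct α₀∉q v*-distinct β∉q tail≢q , boundary-minDeg h≤

symbol-to-front : ∀ {n k} (i : Fin n) (x : Vec (Fin n) (suc k)) → Distinct x →
  ∃ λ (w : Vec (Fin n) k) → Distinct (i ∷ w)
symbol-to-front i (a ∷ w) d with memB i (a ∷ w) in i∈x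
... | false = w , Distinct-unswap a w d i∈x
... | true with memB⇒lookup (a ∷ w) i∈x
...   | zero , refl = w , d
...   | suc r , wr≡i = w [ r ]≔ a , subst (λ b → Distinct (b ∷ (w [ r ]≔ a))) wr≡i (Distinct-swapNbr a w r d)

vertex-with-symbol-at : ∀ {n K} (t : Fin K) (i : Fin n) (x : Vec (Fin n) (suc K)) → Distinct x →
  ∃ λ α₀ → ∃ λ (q : Vec (Fin n) K) → Distinct (α₀ ∷ q) × lookup q t ≡ i
vertex-with-symbol-at t i x d with symbol-to-front i x d
... | w , iw-distinct = lookup w t , w [ t ]≔ i , Distinct-swapNbr i w t iw-distinct , Vecₚ.lookup∘update t w i

∃-freeSymbol : ∀ {n k} (v : Vec (Fin n) k) → 1 ≤ n ∸ k → ∃ λ β → memB β v ≡ false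
∃-freeSymbol v 1≤n-k = first (freeSymbols v) (≤-trans 1≤n-k (freeSymbols-length v)) (∈-freeSymbols⁻ v)
  where
    first : ∀ xs → 1 ≤ length xs → (∀ {β} → β ∈ xs → memB β v ≡ false) → ∃ λ β → memB β v ≡ false
    first (β ∷ _) _ free = β , free (here refl)

∃-otherPosition : ∀ {K} (t : Fin (suc (suc K))) → ∃ λ j → t ≢ j
∃-otherPosition zero = suc zero , λ ()
∃-otherPosition (suc _) = zero , λ ()

minHCut-⊉-subStar : ∀ {N K h} → suc (suc (suc K)) ≤ N → h ≤ suc N ∸ suc (suc (suc K)) →
  (S : Vec (Fin (suc N)) (suc (suc (suc K))) → Bool) → IsMinHCut h (Star (suc N) (suc (suc (suc K)))) S →
  (t : Fin (suc (suc K))) (i : Fin (suc N)) →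
  ¬ (∀ v → v ∈ perms (suc N) (suc (suc (suc K))) → hasSymbolAt (suc t) i v ≡ true → S v ≡ true)
minHCut-⊉-subStar {N} {K} k≤N h≤n-k S (((x , _ , x∈ , _) , _) , S-min) t i
  with vertex-with-symbol-at t i x (∈-perms⁻ (proj₁ (∈-verts-induced⁻ (Star (suc N) (suc (suc (suc K)))) x∈)))
... | α₀ , q , α₀q-distinct , qt≡i with Distinct-∷⁻ α₀q-distinct | ∃-otherPosition t
...   | α₀∉q , q-distinct | j , t≢j with ∃-freeSymbol (α₀ ∷ q) (m<n⇒0<n∸m (s≤s k≤N))
...     | β , β∉ = Boundary.minCut-⊉-subStar q t qt≡i j t≢j h≤n-k q-distinct α₀∉q β∉ S S-min

¬Y∧¬X⇒S : ∀ {s x} → not s ∧ not x ≡ false → x ≡ false → s ≡ true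
¬Y∧¬X⇒S {true} _ _ = refl
¬Y∧¬X⇒S {false} {false} () _

lemma3p3 : (n k h : ℕ) → 3 ≤ k → k ≤ n ∸ 1 → 1 ≤ h → h ≤ n ∸ k →
    (S X : Vec (Fin n) k → Bool) →
    IsMinHCut h (Star n k) S →
    IsComponent (Star n k ─ S) X →
    (t : Fin k) → 1 ≤ toℕ t →
    ((i : Fin n) → J'set n k t S X i ≡ true → IsHCut (h ∸ 1) (StarSub n k t i) S)
    × ((m : ℕ) → IsKappa (h ∸ 1) (Star (n ∸ 1) (k ∸ 1)) m →
         cardFin n (J'set n k t S X) * m ≤ card (Star n k) S)
    × ((i : Fin n) → (Jset n k t S X i ∨ Tset n k t S X i) ≡ true)
lemma3p3 zero (suc (suc (suc _))) _ (s≤s (s≤s (s≤s _))) () _ _ _ _ _ _ _ _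
lemma3p3 (suc _) (suc (suc (suc _))) _ (s≤s (s≤s (s≤s _))) _ _ _ _ _ _ _ zero ()
lemma3p3 n@(suc N) k@(suc K@(suc (suc _))) h (s≤s (s≤s (s≤s _))) k≤n-1 _ h≤n-k S X S-min comp (suc t) _ =
  partA , partB , partC
  where
    J' = J'set n k (suc t) S X

    partA : (i : Fin n) → J' i ≡ true → IsHCut (h ∸ 1) (StarSub n k (suc t) i) S
    partA i = subStar-hCut S X t i (proj₁ S-min) comp

    partB : (m : ℕ) → IsKappa (h ∸ 1) (Star N K) m → cardFin n J' * m ≤ card (Star n k) S
    partB m κ = classes-count-≤ _≟ᵛ_ (λ v → lookup v (suc t)) S (filterᵇ J' (allFin n))
      (perms-unique k) (filterᵇ-unique J' (Unique.allFin⁺ n))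
      λ i i∈J' → SubStar.κ≤card-subStar-cut t i κ (partA i (proj₂ (∈-filterᵇ⁻ {P = J'} {xs = allFin n} i∈J')))

    partC : (i : Fin n) → (Jset n k (suc t) S X i ∨ Tset n k (suc t) S X i) ≡ true
    partC i with Jset n k (suc t) S X i in X∩Sub=∅ | Tset n k (suc t) S X i in Y∩Sub=∅
    ... | true | _ = refl
    ... | false | true = refl
    ... | false | false = ⊥-elim (minHCut-⊉-subStar k≤n-1 h≤n-k S S-min t i λ v v∈ Zv →
      let v∈Sub = ∈-verts-induced⁺ (Star n k) v∈ Zv in
      ¬Y∧¬X⇒S (any-false⇒∀ _ (verts (StarSub n k (suc t) i)) Y∩Sub=∅ v v∈Sub)
              (any-false⇒∀ X (verts (StarSub n k (suc t) i)) X∩Sub=∅ v v∈Sub))
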